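{- Let $n,m\ge 1$ and let $H$ be a finite loopless multigraph containing a VAR$_{n,m}$-gadget with terminals $x_1,\dots,x_n,\overline{x}_1,\dots,\overline{x}_m$. Then in every FO2-coloring of $H$, the vertices $x_1,\dots,x_n$ all have the same color and the vertices $\overline{x}_1,\dots,\overline{x}_m$ all have the opposite color.
   Context: Multigraphs may have parallel edges but no loops. A functional orientation of $H$ is an assignment of directions to a set of edges such that every vertex of positive degree has exactly one edge directed away from it; an edge may be assigned both directions or remain undirected. A 2-coloring is a partition of $V(H)$ into two color classes (not necessarily independent). An FO2-coloring of $H$ is a 2-coloring for which some functional orientation directs every edge whose endpoints have the same color in at least one direction. An EQ-gadget with terminals $u,w$ consists of $u,w$ and seven further private vertices $\gamma,\alpha,\beta,a,b,c,d$ with edges: two parallel edges $u\gamma$, two parallel edges $w\gamma$, single edges $\gamma\alpha,\alpha\beta,\beta\gamma$, two parallel edges $\alpha a$, two parallel edges $\alpha b$, three parallel edges $ab$, two parallel edges $\beta c$, two parallel edges $\beta d$, three parallel edges $cd$. An NE-gadget with terminals $u,w$ consists of vertices $u,p,q,w$, an EQ-gadget with terminals $u,p$, three parallel edges $pq$, and an EQ-gadget with terminals $q,w$. A VAR$_{n,m}$-gadget with terminals $x_1,\dots,x_n,\overline{x}_1,\dots,\overline{x}_m$ (all distinct) consists of an EQ-gadget with terminals $x_i,x_{i+1}$ for each $1\le i<n$, an EQ-gadget with terminals $\overline{x}_j,\overline{x}_{j+1}$ for each $1\le j<m$, and an NE-gadget with terminals $x_n,\overline{x}_m$, all sub-gadgets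 having pairwise disjoint sets of non-terminal vertices. $H$ contains a gadget if all its vertices and edges belong to $H$ and every non-terminal vertex of the gadget is incident in $H$ only to edges of the gadget; the terminals may have further edges in $H$. -}

module Defs where

open import Data.Nat using (ℕ; suc)
open import Data.Fin using (Fin; inject₁; fromℕ) renaming (suc to fsuc)
open import Data.Bool using (Bool)
open import Data.Product using (_×_; _,_; proj₁; proj₂; ∃; ∃-syntax)
open import Data.Sum using (_⊎_)
open import Data.List using (List; []; _∷_; _++_; length; lookup; concatMap; replicate)
open import Data.Empty using (⊥)
open import Data.Unit using (⊤)
open import Relation.Binary.PropositionalEquality using (_≡_; _≢_)
open import Function.Definitions using (Injective)

-- Finite loopless multigraphs: vertices Fin nV, edges Fin nE (so parallel
-- edges are distinct edge identifiers with the same endpoints).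

record Multigraph : Set where
  field
    nV    : ℕ
    nE    : ℕ
    ends  : Fin nE → Fin nV × Fin nV
    loopless : ∀ e → proj₁ (ends e) ≢ proj₂ (ends e)

open Multigraph public

Incident : (H : Multigraph) → Fin (nE H) → Fin (nV H) → Set
Incident H e v = (proj₁ (ends H e) ≡ v) ⊎ (proj₂ (ends H e) ≡ v)

-- direction assigned to an edge (u,w) = ends e:
--   none : undirected, fwd : u → w, bwd : w → u, both : both directions
data Dir : Set where
  none fwd bwd both : Dir

DirectedAway : (H : Multigraph) → (Fin (nE H) → Dir) → Fin (nE H) → Fin (nV H) → Set
DirectedAway H o e v with o e
... | none = ⊥
... | fwd  = proj₁ (ends H e) ≡ v
... | bwd  = proj₂ (ends H e) ≡ v
... | both = (proj₁ (ends H e) ≡ v) ⊎ (proj₂ (ends H e) ≡ v)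

IsFunctionalOrientation : (H : Multigraph) → (Fin (nE H) → Dir) → Set
IsFunctionalOrientation H o =
  ∀ (v : Fin (nV H)) → (∃[ e ] Incident H e v) →
    ∃[ e ] (DirectedAway H o e v × (∀ e′ → DirectedAway H o e′ v → e′ ≡ e))

-- a 2-colouring is a map V(H) → Bool (colour classes need not be independent)
IsFO2Coloring : (H : Multigraph) → (Fin (nV H) → Bool) → Set
IsFO2Coloring H col =
  ∃[ o ] (IsFunctionalOrientation H o ×
          (∀ e → col (proj₁ (ends H e)) ≡ col (proj₂ (ends H e)) → o e ≢ none))

-- Gadgets: a vertex type, a list of (undirected) edges with multiplicity,
-- and a predicate marking the non-terminal vertices.

record Gadget : Set₁ where
  field
    GV       : Set
    gedges   : List (GV × GV)
    NonTerm  : GV → Set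

open Gadget public

record Contains (H : Multigraph) (G : Gadget) : Set where
  field
    vmap     : GV G → Fin (nV H)
    vmap-inj : Injective _≡_ _≡_ vmap
    emap     : Fin (length (gedges G)) → Fin (nE H)
    emap-inj : Injective _≡_ _≡_ emap
    emap-ends : ∀ k → let (a , b) = lookup (gedges G) k in
                  (ends H (emap k) ≡ (vmap a , vmap b)) ⊎ (ends H (emap k) ≡ (vmap b , vmap a))
    private-nt : ∀ t → NonTerm G t → ∀ e → Incident H e (vmap t) → ∃[ k ] emap k ≡ e

data EqInt : Set where
  γ α β a b c d : EqInt

eqEdges : {T : Set} → T → T → (EqInt → T) → List (T × T)
eqEdges u w ι =
  replicate 2 (u , ι γ) ++ replicate 2 (w , ι γ) ++
  (ι γ , ι α) ∷ (ι α , ι β) ∷ (ι β , ι γ) ∷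
  replicate 2 (ι α , ι a) ++ replicate 2 (ι α , ι b) ++ replicate 3 (ι a , ι b) ++
  replicate 2 (ι β , ι c) ++ replicate 2 (ι β , ι d) ++ replicate 3 (ι c , ι d)

data NeInt : Set where
  p q   : NeInt
  left  : EqInt → NeInt
  right : EqInt → NeInt

neEdges : {T : Set} → T → T → (NeInt → T) → List (T × T)
neEdges u w ι =
  eqEdges u (ι p) (λ z → ι (left z)) ++ replicate 3 (ι p , ι q) ++
  eqEdges (ι q) w (λ z → ι (right z))

-- vertices of VAR_{n,m} with n = suc n′, m = suc m′
data VarV (n′ m′ : ℕ) : Set where
  X   : Fin (suc n′) → VarV n′ m′
  Xb  : Fin (suc m′) → VarV n′ m′
  XE  : Fin n′ → EqInt → VarV n′ m′
  XbE : Fin m′ → EqInt → VarV n′ m′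
  NE  : NeInt → VarV n′ m′

VarNonTerm : ∀ {n′ m′} → VarV n′ m′ → Set
VarNonTerm (X _)     = ⊥
VarNonTerm (Xb _)    = ⊥
VarNonTerm (XE _ _)  = ⊤
VarNonTerm (XbE _ _) = ⊤
VarNonTerm (NE _)    = ⊤

varEdges : (n′ m′ : ℕ) → List (VarV n′ m′ × VarV n′ m′)
varEdges n′ m′ =
  concatMap (λ i → eqEdges (X (inject₁ i)) (X (fsuc i)) (XE i)) (Data.List.allFin n′) ++
  concatMap (λ j → eqEdges (Xb (inject₁ j)) (Xb (fsuc j)) (XbE j)) (Data.List.allFin m′) ++
  neEdges (X (fromℕ n′)) (Xb (fromℕ m′)) NE

VAR : (n′ m′ : ℕ) → Gadget
VAR n′ m′ = record { GV = VarV n′ m′ ; gedges = varEdges n′ m′ ; NonTerm = VarNonTerm }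

module Submission where

-- Fix an FO2-colouring col of H with its functional orientation o.  Each vertex
-- has at most one out-edge, and every monochromatic edge leaves one of its ends.
-- Hence (i) two parallel monochromatic x–y edges use up the out-edge of x (or y),
-- and (ii) three parallel edges are never monochromatic.  In an EQ-gadget the
-- triple edges force a ≠ b and c ≠ d; so α agrees with a or b and its out-edge
-- goes into {a,b}, likewise for β, which makes αβ bichromatic; then γ agrees
-- with α or β and its out-edge lies in the triangle, so neither double edge uγ,
-- wγ can be monochromatic, i.e. u and w both differ from γ and agree.  An
-- NE-gadget is EQ, bichromatic triple edge, EQ, so its terminals differ, and a
-- VAR-gadget is two EQ-chains joined by an NE-gadget.

open import Defs
open import Data.Nat using (ℕ; zero; suc)
open import Data.Fin using (Fin; zero; suc; inject₁; fromℕ; #_) renaming (_≟_ to _≟ᶠ_)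
open import Data.Fin.Properties using (suc-injective)
open import Data.Bool using (Bool) renaming (_≟_ to _≟ᵇ_)
open import Data.Bool.Properties using (¬-not)
open import Data.Product using (_×_; _,_; proj₁; proj₂)
open import Data.Sum using (_⊎_; inj₁; inj₂; [_,_]′; swap)
open import Data.Empty using (⊥; ⊥-elim)
open import Data.List using (List; []; _∷_; _++_; length; lookup; concatMap; tabulate; replicate; allFin)
open import Data.List.Relation.Unary.Any using (Any; here; there)
open import Data.List.Membership.Propositional using (_∈_)
import Data.List.Membership.DecPropositional as DecMembership
open import Function using (_∘_)
open import Relation.Nullary using (yes; no)
open import Relation.Nullary.Decidable using (False; toWitnessFalse)
open import Relation.Binary.PropositionalEquality
  using (_≡_; _≢_; refl; sym; trans; cong; subst)

both-differ : ∀ {x y z : Bool} → x ≢ z → y ≢ z → x ≡ y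
both-differ x≢z y≢z = trans (¬-not x≢z) (sym (¬-not y≢z))

one-of : ∀ {x y : Bool} (z : Bool) → x ≢ y → z ≡ x ⊎ z ≡ y
one-of {x} z x≢y with z ≟ᵇ x
... | yes z≡x = inj₁ z≡x
... | no  z≢x = inj₂ (trans (¬-not z≢x) (sym (¬-not (x≢y ∘ sym))))

-- Positional sublists: M ⊑ L when the positions of M map injectively into those
-- of L, preserving entries.  Gadget edge lists are cut into sub-gadget lists by ⊑.
record _⊑_ {A : Set} (M L : List A) : Set where
  field
    position  : Fin (length M) → Fin (length L)
    injective : ∀ {i j} → position i ≡ position j → i ≡ j
    preserves : ∀ k → lookup L (position k) ≡ lookup M k

open _⊑_

⊑-trans : ∀ {A : Set} {M L K : List A} → M ⊑ L → L ⊑ K → M ⊑ K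
⊑-trans s t = record
  { position  = position t ∘ position s
  ; injective = injective s ∘ injective t
  ; preserves = λ k → trans (preserves t (position s k)) (preserves s k)
  }

⊑-++ˡ : ∀ {A : Set} (xs ys : List A) → xs ⊑ (xs ++ ys)
⊑-++ˡ []       ys = record { position = λ () ; injective = λ { {()} } ; preserves = λ () }
⊑-++ˡ (x ∷ xs) ys = record { position = pos ; injective = inj ; preserves = pres }
  where
  s = ⊑-++ˡ xs ys
  pos : Fin (length (x ∷ xs)) → Fin (length (x ∷ xs ++ ys))
  pos zero    = zero
  pos (suc k) = suc (position s k)
  inj : ∀ {i j} → pos i ≡ pos j → i ≡ j
  inj {zero}  {zero}  _  = refl
  inj {suc i} {suc j} eq = cong suc (injective s (suc-injective eq))
  pres : ∀ k → lookup (x ∷ xs ++ ys) (pos k) ≡ lookup (x ∷ xs) k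
  pres zero    = refl
  pres (suc k) = preserves s k

⊑-++ʳ : ∀ {A : Set} (xs ys : List A) → ys ⊑ (xs ++ ys)
⊑-++ʳ []       ys = record { position = λ k → k ; injective = λ eq → eq ; preserves = λ _ → refl }
⊑-++ʳ (x ∷ xs) ys = record
  { position  = suc ∘ position s
  ; injective = injective s ∘ suc-injective
  ; preserves = preserves s
  }
  where s = ⊑-++ʳ xs ys

⊑-concatMap : ∀ {A B : Set} (h : B → List A) {n} (g : Fin n → B) (i : Fin n) →
              h (g i) ⊑ concatMap h (tabulate g)
⊑-concatMap h g zero    = ⊑-++ˡ (h (g zero)) _
⊑-concatMap h g (suc i) = ⊑-trans (⊑-concatMap h (g ∘ suc) i) (⊑-++ʳ (h (g zero)) _)

constant-chain : ∀ {B : Set} n (f : Fin (suc n) → B) →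
                 (∀ i → f (inject₁ i) ≡ f (suc i)) → ∀ i → f i ≡ f zero
constant-chain n       f step zero    = refl
constant-chain (suc n) f step (suc i) =
  trans (sym (step i)) (constant-chain n (f ∘ inject₁) (step ∘ inject₁) i)

module FO2 (H : Multigraph) (col : Fin (nV H) → Bool) (o : Fin (nE H) → Dir)
           (functional : IsFunctionalOrientation H o)
           (mono-directed : ∀ e → col (proj₁ (ends H e)) ≡ col (proj₂ (ends H e)) → o e ≢ none)
           where

  V : Set
  V = Fin (nV H)

  E : Set
  E = Fin (nE H)

  Away : E → V → Set
  Away = DirectedAway H o

  Between : E → V → V → Set
  Between e x y = (ends H e ≡ (x , y)) ⊎ (ends H e ≡ (y , x))

  between-sym : ∀ {e x y} → Between e x y → Between e y x
  between-sym (inj₁ eq) = inj₂ eq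
  between-sym (inj₂ eq) = inj₁ eq

  away-incident : ∀ e v → Away e v → Incident H e v
  away-incident e v away with o e
  ... | fwd  = inj₁ away
  ... | bwd  = inj₂ away
  ... | both = away

  out-unique : ∀ {e e′ v} → Away e v → Away e′ v → e ≡ e′
  out-unique {e} {e′} {v} away away′ with functional v (e , away-incident e v away)
  ... | _ , _ , only = trans (only e away) (sym (only e′ away′))

  directed-leaves-end : ∀ e → o e ≢ none → Away e (proj₁ (ends H e)) ⊎ Away e (proj₂ (ends H e))
  directed-leaves-end e directed with o e
  ... | none = ⊥-elim (directed refl)
  ... | fwd  = inj₁ refl
  ... | bwd  = inj₂ refl
  ... | both = inj₁ (inj₁ refl)

  monochromatic-out : ∀ {e x y} → Between e x y → col x ≡ col y → Away e x ⊎ Away e y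
  monochromatic-out {e} (inj₁ refl) same = directed-leaves-end e (mono-directed e same)
  monochromatic-out {e} (inj₂ refl) same =
    swap (directed-leaves-end e (mono-directed e (sym same)))

  -- Two monochromatic parallel x–y edges: one of them is the out-edge of x
  -- (they cannot both leave y).
  double-out : ∀ {e₁ e₂ x y} → Between e₁ x y → Between e₂ x y → e₁ ≢ e₂ →
               col x ≡ col y → Away e₁ x ⊎ Away e₂ x
  double-out b₁ b₂ e₁≢e₂ same with monochromatic-out b₁ same | monochromatic-out b₂ same
  ... | inj₁ away₁ | _          = inj₁ away₁
  ... | inj₂ _     | inj₁ away₂ = inj₂ away₂
  ... | inj₂ away₁ | inj₂ away₂ = ⊥-elim (e₁≢e₂ (out-unique away₁ away₂))

  -- Three parallel edges are never monochromatic: two of them would leave the same end.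
  triple-bichromatic : ∀ {e₁ e₂ e₃ x y} → Between e₁ x y → Between e₂ x y → Between e₃ x y →
                       e₁ ≢ e₂ → e₁ ≢ e₃ → e₂ ≢ e₃ → col x ≢ col y
  triple-bichromatic b₁ b₂ b₃ e₁≢e₂ e₁≢e₃ e₂≢e₃ same
    with monochromatic-out b₁ same | monochromatic-out b₂ same | monochromatic-out b₃ same
  ... | inj₁ a₁ | inj₁ a₂ | _       = e₁≢e₂ (out-unique a₁ a₂)
  ... | inj₂ a₁ | inj₂ a₂ | _       = e₁≢e₂ (out-unique a₁ a₂)
  ... | inj₁ a₁ | inj₂ _  | inj₁ a₃ = e₁≢e₃ (out-unique a₁ a₃)
  ... | inj₂ a₁ | inj₁ _  | inj₂ a₃ = e₁≢e₃ (out-unique a₁ a₃)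
  ... | inj₁ _  | inj₂ a₂ | inj₂ a₃ = e₂≢e₃ (out-unique a₂ a₃)
  ... | inj₂ _  | inj₁ a₂ | inj₁ a₃ = e₂≢e₃ (out-unique a₂ a₃)

  record Embedding {T : Set} (vm : T → V) (L : List (T × T)) : Set where
    field
      edge           : Fin (length L) → E
      edge-injective : ∀ {i j} → edge i ≡ edge j → i ≡ j
      edge-joins     : ∀ k → Between (edge k) (vm (proj₁ (lookup L k))) (vm (proj₂ (lookup L k)))

  restrict : ∀ {T : Set} {vm : T → V} {M L} → M ⊑ L → Embedding vm L → Embedding vm M
  restrict {vm = vm} s emb = record
    { edge           = edge ∘ position s
    ; edge-injective = injective s ∘ edge-injective
    ; edge-joins     = λ k → subst (λ xy → Between (edge (position s k)) (vm (proj₁ xy)) (vm (proj₂ xy)))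
                                   (preserves s k) (edge-joins (position s k))
    }
    where open Embedding emb

  module Within {T : Set} {vm : T → V} {L : List (T × T)} (emb : Embedding vm L) where
    open Embedding emb public
    open DecMembership (_≟ᶠ_ {length L}) using (_∈?_)

    distinct : ∀ {i j} → i ≢ j → edge i ≢ edge j
    distinct i≢j = i≢j ∘ edge-injective

    Owns : V → List (Fin (length L)) → Set
    Owns v = Any (λ k → Away (edge k) v)

    owner-listed : ∀ {v ks j} → Owns v ks → Away (edge j) v → j ∈ ks
    owner-listed (here away)  away′ = here (edge-injective (out-unique away′ away))
    owner-listed (there owns) away′ = there (owner-listed owns away′)

    not-owned : ∀ {v ks} → Owns v ks → ∀ {j} {unlisted : False (j ∈? ks)} → Away (edge j) v → ⊥
    not-owned owns {unlisted = unlisted} = toWitnessFalse unlisted ∘ owner-listed owns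

    fork : ∀ {x y z i j k l} → col (vm y) ≢ col (vm z) →
           Between (edge i) (vm x) (vm y) → Between (edge j) (vm x) (vm y) → i ≢ j →
           Between (edge k) (vm x) (vm z) → Between (edge l) (vm x) (vm z) → k ≢ l →
           Owns (vm x) (i ∷ j ∷ k ∷ l ∷ [])
    fork {x} y≢z bi bj i≢j bk bl k≢l with one-of (col (vm x)) y≢z
    ... | inj₁ x≡y = [ here , there ∘ here ]′ (double-out bi bj (distinct i≢j) x≡y)
    ... | inj₂ x≡z = [ there ∘ there ∘ here , there ∘ there ∘ there ∘ here ]′
                       (double-out bk bl (distinct k≢l) x≡z)

  -- EQ-gadget.  Edge positions: 0,1: uγ   2,3: wγ   4: γα   5: αβ   6: βγ
  -- 7,8: αa   9,10: αb   11–13: ab   14,15: βc   16,17: βd   18–20: cd.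
  eq-gadget : ∀ {T : Set} {vm : T → V} (u w : T) (ι : EqInt → T) →
              Embedding vm (eqEdges u w ι) → col (vm u) ≡ col (vm w)
  eq-gadget {vm = vm} u w ι emb = both-differ u≢γ w≢γ
    where
    open Within emb
    ν : EqInt → V
    ν = vm ∘ ι

    a≢b : col (ν a) ≢ col (ν b)
    a≢b = triple-bichromatic (edge-joins (# 11)) (edge-joins (# 12)) (edge-joins (# 13))
                             (distinct λ ()) (distinct λ ()) (distinct λ ())

    c≢d : col (ν c) ≢ col (ν d)
    c≢d = triple-bichromatic (edge-joins (# 18)) (edge-joins (# 19)) (edge-joins (# 20))
                             (distinct λ ()) (distinct λ ()) (distinct λ ())

    -- a ≠ b and c ≠ d, so the out-edges of α and β stay inside their ears.
    α-owned : Owns (ν α) (# 7 ∷ # 8 ∷ # 9 ∷ # 10 ∷ [])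
    α-owned = fork a≢b (edge-joins (# 7)) (edge-joins (# 8)) (λ ())
                       (edge-joins (# 9)) (edge-joins (# 10)) (λ ())

    β-owned : Owns (ν β) (# 14 ∷ # 15 ∷ # 16 ∷ # 17 ∷ [])
    β-owned = fork c≢d (edge-joins (# 14)) (edge-joins (# 15)) (λ ())
                       (edge-joins (# 16)) (edge-joins (# 17)) (λ ())

    -- αβ cannot leave α or β, so it is bichromatic.
    α≢β : col (ν α) ≢ col (ν β)
    α≢β same = [ not-owned α-owned , not-owned β-owned ]′ (monochromatic-out (edge-joins (# 5)) same)

    -- γ agrees with α or β; the triangle edge to it cannot leave that vertex,
    -- so it leaves γ.
    γ-owned : Owns (ν γ) (# 4 ∷ # 6 ∷ [])
    γ-owned with one-of (col (ν γ)) α≢β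
    ... | inj₁ γ≡α = [ here , ⊥-elim ∘ not-owned α-owned ]′
                       (monochromatic-out (edge-joins (# 4)) γ≡α)
    ... | inj₂ γ≡β = [ there ∘ here , ⊥-elim ∘ not-owned β-owned ]′
                       (monochromatic-out (between-sym (edge-joins (# 6))) γ≡β)

    -- Since γ's out-edge lies in the triangle, neither double edge to a terminal
    -- is monochromatic.
    u≢γ : col (vm u) ≢ col (ν γ)
    u≢γ same = [ not-owned γ-owned , not-owned γ-owned ]′
      (double-out (between-sym (edge-joins (# 0))) (between-sym (edge-joins (# 1))) (distinct λ ()) (sym same))

    w≢γ : col (vm w) ≢ col (ν γ)
    w≢γ same = [ not-owned γ-owned , not-owned γ-owned ]′
      (double-out (between-sym (edge-joins (# 2))) (between-sym (edge-joins (# 3))) (distinct λ ()) (sym same))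

  ne-gadget : ∀ {T : Set} {vm : T → V} (u w : T) (ι : NeInt → T) →
              Embedding vm (neEdges u w ι) → col (vm u) ≢ col (vm w)
  ne-gadget {T} {vm} u w ι emb u≡w =
    p≢q (trans (sym u≡p) (trans u≡w (sym q≡w)))
    where
    eq₁ triple eq₂ : List (T × T)
    eq₁    = eqEdges u (ι p) (ι ∘ left)
    triple = replicate 3 (ι p , ι q)
    eq₂    = eqEdges (ι q) w (ι ∘ right)

    rest : Embedding vm (triple ++ eq₂)
    rest = restrict (⊑-++ʳ eq₁ (triple ++ eq₂)) emb

    u≡p : col (vm u) ≡ col (vm (ι p))
    u≡p = eq-gadget u (ι p) (ι ∘ left) (restrict (⊑-++ˡ eq₁ (triple ++ eq₂)) emb)

    q≡w : col (vm (ι q)) ≡ col (vm w)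
    q≡w = eq-gadget (ι q) w (ι ∘ right) (restrict (⊑-++ʳ triple eq₂) rest)

    p≢q : col (vm (ι p)) ≢ col (vm (ι q))
    p≢q = triple-bichromatic (edge-joins (# 0)) (edge-joins (# 1)) (edge-joins (# 2))
                             (distinct λ ()) (distinct λ ()) (distinct λ ())
      where open Within (restrict (⊑-++ˡ triple eq₂) rest)

  var-gadget : ∀ n′ m′ (vm : VarV n′ m′ → V) → Embedding vm (varEdges n′ m′) →
               let x  = λ i → col (vm (X i))
                   xb = λ j → col (vm (Xb j))
               in ((i i′ : Fin (suc n′)) → x i ≡ x i′) ×
                  ((j j′ : Fin (suc m′)) → xb j ≡ xb j′) ×
                  ((i : Fin (suc n′)) (j : Fin (suc m′)) → x i ≢ xb j)
  var-gadget n′ m′ vm emb =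
      (λ i i′ → trans (x-const i) (sym (x-const i′)))
    , (λ j j′ → trans (xb-const j) (sym (xb-const j′)))
    , λ i j xi≡xbj → last-differ
        (trans (x-const (fromℕ n′)) (trans (sym (x-const i)) (trans xi≡xbj
               (trans (xb-const j) (sym (xb-const (fromℕ m′)))))))
    where
    Edges : Set
    Edges = List (VarV n′ m′ × VarV n′ m′)

    x-block : Fin n′ → Edges
    x-block i = eqEdges (X (inject₁ i)) (X (suc i)) (XE i)

    xb-block : Fin m′ → Edges
    xb-block j = eqEdges (Xb (inject₁ j)) (Xb (suc j)) (XbE j)

    xs xbs ne : Edges
    xs  = concatMap x-block (allFin n′)
    xbs = concatMap xb-block (allFin m′)
    ne  = neEdges (X (fromℕ n′)) (Xb (fromℕ m′)) NE

    rest : Embedding vm (xbs ++ ne)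
    rest = restrict (⊑-++ʳ xs (xbs ++ ne)) emb

    x-const : ∀ i → col (vm (X i)) ≡ col (vm (X zero))
    x-const = constant-chain n′ (λ i → col (vm (X i))) λ i →
      eq-gadget _ _ (XE i) (restrict (⊑-trans (⊑-concatMap x-block (λ k → k) i) (⊑-++ˡ xs (xbs ++ ne))) emb)

    xb-const : ∀ j → col (vm (Xb j)) ≡ col (vm (Xb zero))
    xb-const = constant-chain m′ (λ j → col (vm (Xb j))) λ j →
      eq-gadget _ _ (XbE j) (restrict (⊑-trans (⊑-concatMap xb-block (λ k → k) j) (⊑-++ˡ xbs ne)) rest)

    last-differ : col (vm (X (fromℕ n′))) ≢ col (vm (Xb (fromℕ m′)))
    last-differ = ne-gadget _ _ NE (restrict (⊑-++ʳ xbs ne) rest)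

-- Lemma 8: in every FO2-colouring the x's share a colour, the x̄'s share the
-- other one.
lemma8 : (n′ m′ : ℕ) (H : Multigraph) (C : Contains H (VAR n′ m′))
         (col : Fin (nV H) → Bool) → IsFO2Coloring H col →
         let x = λ i → col (Contains.vmap C (X i))
             xb = λ j → col (Contains.vmap C (Xb j))
         in ((i i′ : Fin (suc n′)) → x i ≡ x i′) ×
            ((j j′ : Fin (suc m′)) → xb j ≡ xb j′) ×
            ((i : Fin (suc n′)) (j : Fin (suc m′)) → x i ≢ xb j)
lemma8 n′ m′ H C col (o , functional , mono-directed) =
  var-gadget n′ m′ vmap (record { edge = emap ; edge-injective = emap-inj ; edge-joins = emap-ends })
  where
  open Contains C
  open FO2 H col o functional mono-directed
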